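{- Let $p$ be a prime. If $\mathcal{C}$ is a linear $[n,k,d]_p$ code with Singleton defect $s$ (an A$^s$MDS code), then \[d_L(\mathcal{C})\le\lfloor\mu_p(n-k+1-s)\rfloor=\lfloor d\cdot\mu_p\rfloor.\]
   Context: A linear $[n,k,d]_p$ code is a $k$-dimensional subspace of $\mathbb{Z}_p^n$ with minimum Hamming distance $d$; its Singleton defect is $n-k+1-d$, and a code of Singleton defect $s$ is called A$^s$MDS. The Lee weight of $a\in\mathbb{Z}_p$ (as an integer in $\{0,\dots,p-1\}$) is $\min\{a,p-a\}$, the Lee weight of a vector is the sum over coordinates, and $d_L(\mathcal{C})$ is the minimum Lee weight of a nonzero codeword. $\mu_p$ is the average Lee weight of the nonzero elements of $\mathbb{Z}_p$: $\mu_2=1$ and $\mu_p=\frac{p+1}{4}$ for odd $p$. -}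

module Defs where

open import Data.Nat using (ℕ; zero; suc; _+_; _*_; _∸_; _≤_; _⊓_; NonZero)
open import Data.Nat.DivMod using (_mod_; _/_)
open import Data.Fin using (Fin; toℕ)
open import Data.Vec using (Vec; lookup; tabulate; replicate; zipWith; map)
open import Data.List using (List; allFin) renaming (map to lmap)
open import Data.Nat.ListAction using (sum)
open import Data.Product using (Σ; _×_; ∃)
open import Relation.Binary.PropositionalEquality using (_≡_; _≢_)

module _ (p : ℕ) .{{_ : NonZero p}} where

  Word : ℕ → Set
  Word n = Vec (Fin p) n

  zeroWord : (n : ℕ) → Word n
  zeroWord n = replicate n (0 mod p)

  _+ₚ_ : Fin p → Fin p → Fin p
  a +ₚ b = (toℕ a + toℕ b) mod p

  _*ₚ_ : Fin p → Fin p → Fin p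
  a *ₚ b = (toℕ a * toℕ b) mod p

  addW : ∀ {n} → Word n → Word n → Word n
  addW = zipWith _+ₚ_

  scaleW : ∀ {n} → Fin p → Word n → Word n
  scaleW c = map (c *ₚ_)

  lincomb : ∀ {n k} → (Fin k → Fin p) → (Fin k → Word n) → Word n
  lincomb {n} {k} c g =
    tabulate λ j → sum (lmap (λ i → toℕ (c i) * toℕ (lookup (g i) j)) (allFin k)) mod p

  Code : ℕ → Set₁
  Code n = Word n → Set

  IsSubspace : ∀ {n} → Code n → Set
  IsSubspace {n} C =
    C (zeroWord n)
    × (∀ x y → C x → C y → C (addW x y))
    × (∀ a x → C x → C (scaleW a x))

  HasDimension : ∀ {n} → Code n → ℕ → Set
  HasDimension {n} C k =
    Σ (Fin k → Word n) λ g →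
      (∀ i → C (g i))
      × (∀ c → lincomb c g ≡ zeroWord n → ∀ i → c i ≡ 0 mod p)
      × (∀ x → C x → ∃ λ c → x ≡ lincomb c g)

  hamming : ∀ {n} → Word n → ℕ
  hamming {n} x = sum (lmap (λ j → nz (toℕ (lookup x j))) (allFin n))
    where
      nz : ℕ → ℕ
      nz zero = 0
      nz (suc _) = 1

  leeElem : Fin p → ℕ
  leeElem a = toℕ a ⊓ (p ∸ toℕ a)

  lee : ∀ {n} → Word n → ℕ
  lee {n} x = sum (lmap (λ j → leeElem (lookup x j)) (allFin n))

  IsMinWeight : ∀ {n} → (Word n → ℕ) → Code n → ℕ → Set
  IsMinWeight {n} w C m =
    (∃ λ x → C x × x ≢ zeroWord n × w x ≡ m)
    × (∀ x → C x → x ≢ zeroWord n → m ≤ w x)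

  IsLinearCode : (n k d : ℕ) → Code n → Set
  IsLinearCode n k d C = IsSubspace C × HasDimension C k × IsMinWeight hamming C d

  IsMinLeeDistance : ∀ {n} → Code n → ℕ → Set
  IsMinLeeDistance C dL = IsMinWeight lee C dL

-- μ_p = μnum p / μden p  (μ_2 = 1, μ_p = (p+1)/4 for odd p)
μnum : ℕ → ℕ
μnum 2 = 1
μnum p = p + 1

μden : ℕ → ℕ
μden 2 = 1
μden p = 4

floorμ : ℕ → ℕ → ℕ
floorμ p m = (μnum p * m) / suc (μden p ∸ 1)

{-# OPTIONS --safe #-}
-- Take a codeword x of Hamming weight d. Its p − 1 nonzero multiples a·x are nonzero codewords, so
-- (p − 1)·d_L ≤ Σₐ lee(a·x). Multiplication by a nonzero element permutes ℤ_p, so every nonzero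
-- coordinate of x contributes Σ_{b ∈ ℤ_p} lee(b) = ⌊p²/4⌋ to that sum, giving (p − 1)·d_L ≤ d·⌊p²/4⌋,
-- i.e. d_L ≤ d for p = 2 and 4·d_L ≤ (p + 1)·d for odd p. The Singleton defect only enters through
-- n + 1 − k − s = d.
module Submission where

open import Defs
open import Data.Nat using (ℕ; zero; suc; _+_; _*_; _∸_; _≤_; _<_; _⊓_; _%_; ∣_-_∣; NonZero; z≤n; s≤s)
open import Data.Nat.Properties
  using ( +-*-semiring; +-assoc; +-identityʳ; +-mono-≤; +-cancelʳ-≡; +-∸-assoc; m+n∸n≡m; m+n∸m≡n; m≤n+m
        ; *-comm; *-identityˡ; *-identityʳ; *-zeroʳ; *-monoʳ-≤; *-cancelˡ-≤
        ; ⊓-zeroʳ; ⊔-pres-<m; <⇒≤; ≤-<-trans; 1+n≰n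
        ; ∣m+n-m+o∣≡∣n-o∣; *-distribʳ-∣-∣; ∣m-n∣≡0⇒m≡n; ∣m-n∣≤m⊔n; module ≤-Reasoning )
open import Data.Nat.DivMod using (_mod_; _/_; m≡m%n+[m/n]*n; m%n<n; m<n⇒m%n≡m; n/1≡n; m*n/n≡m; /-monoˡ-≤)
open import Data.Nat.Divisibility using (_∣_; divides; m%n≡0⇒n∣m; n∣m⇒m%n≡0)
open import Data.Nat.Primality using (Prime; euclidsLemma; prime⇒irreducible; ¬prime[0]; ¬prime[1])
open import Data.Nat.Tactic.RingSolver using (solve; solve-∀)
import Data.Nat.ListAction as List
open import Algebra.Properties.Semiring.Sum +-*-semiring
  using (sum-syntax; sum-cong-≗; sum-permute; sum-init-last; ∑-comm; ∑-distrib-+; *-distribʳ-sum)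
open import Data.Fin using (Fin; zero; suc; toℕ; fromℕ; inject₁; punchOut; _≟_)
open import Data.Fin.Properties
  using (toℕ-fromℕ<; toℕ-fromℕ; toℕ-inject₁; toℕ-injective; toℕ<n; punchOut-injective; injective⇒≤; any?)
open import Data.Fin.Permutation as Permutation using (Permutation)
open import Data.Vec using ([]; _∷_; [_]; lookup)
open import Data.Vec.Properties using (lookup-map; ∷-injective)
open import Data.List as L using (allFin; tabulate) renaming (map to lmap)
open import Data.List.Properties using (map-tabulate)
open import Data.Product using (_×_; _,_; proj₁; proj₂)
open import Data.Sum using ([_,_]′)
open import Data.Empty using (⊥-elim)
open import Function using (_∘_)
open import Function.Definitions using (Injective; StrictlySurjective)
open import Relation.Binary.PropositionalEquality
  using (_≡_; _≢_; refl; sym; trans; cong; cong₂; subst; subst₂; module ≡-Reasoning)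
open import Relation.Nullary using (yes; no; contradiction)

sum-const : ∀ n c → ∑[ i < n ] c ≡ n * c
sum-const zero    c = refl
sum-const (suc n) c = cong (c +_) (sum-const n c)

sum-mono-≤ : ∀ {n} {f g : Fin n → ℕ} → (∀ i → f i ≤ g i) → ∑[ i < n ] f i ≤ ∑[ i < n ] g i
sum-mono-≤ {zero}  f≤g = z≤n
sum-mono-≤ {suc n} f≤g = +-mono-≤ (f≤g zero) (sum-mono-≤ (f≤g ∘ suc))

sum-suc : ∀ {n} (f : Fin n → ℕ) → ∑[ i < n ] suc (f i) ≡ n + ∑[ i < n ] f i
sum-suc {n} f = begin
  ∑[ i < n ] (1 + f i)           ≡⟨ ∑-distrib-+ (λ _ → 1) f ⟩
  ∑[ i < n ] 1 + ∑[ i < n ] f i  ≡⟨ cong (_+ ∑[ i < n ] f i) (trans (sum-const n 1) (*-identityʳ n)) ⟩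
  n + ∑[ i < n ] f i             ∎
  where open ≡-Reasoning

sum-tabulate : ∀ {n} (f : Fin n → ℕ) → List.sum (tabulate f) ≡ ∑[ i < n ] f i
sum-tabulate {zero}  f = refl
sum-tabulate {suc n} f = cong (f zero +_) (sum-tabulate (f ∘ suc))

sum-allFin : ∀ {n} {f g : Fin n → ℕ} → (∀ i → f i ≡ g i) →
             List.sum (lmap f (allFin n)) ≡ ∑[ i < n ] g i
sum-allFin {n} {f} f≗g =
  trans (cong List.sum (map-tabulate (λ i → i) f)) (trans (sum-tabulate f) (sum-cong-≗ f≗g))

injective⇒strictlySurjective : ∀ {n} {f : Fin n → Fin n} → Injective _≡_ _≡_ f → StrictlySurjective _≡_ f
injective⇒strictlySurjective {suc n} {f} f-inj y with any? (λ x → f x ≟ y)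
... | yes hit  = hit
-- if y were missed, punching it out of the image would inject Fin (suc n) into Fin n
... | no  miss = contradiction (injective⇒≤ punchOut-injective′) (1+n≰n {n})
  where
  y≢f : ∀ x → y ≢ f x
  y≢f x y≡fx = miss (x , sym y≡fx)

  punchOut-injective′ : Injective _≡_ _≡_ (λ x → punchOut (y≢f x))
  punchOut-injective′ {x} {x′} eq = f-inj (punchOut-injective (y≢f x) (y≢f x′) eq)

sum-reindex : ∀ {n} (f : Fin n → ℕ) (σ : Fin n → Fin n) → Injective _≡_ _≡_ σ →
              ∑[ i < n ] f (σ i) ≡ ∑[ i < n ] f i
sum-reindex f σ σ-inj = sym (sum-permute f π)
  where
  σ-onto : StrictlySurjective _≡_ σ
  σ-onto = injective⇒strictlySurjective σ-inj

  π : Permutation _ _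
  π = Permutation.permutation σ (proj₁ ∘ σ-onto) (proj₂ ∘ σ-onto) (λ x → σ-inj (proj₂ (σ-onto (σ x))))

m%d≡n%d⇒d∣∣m-n∣ : ∀ m n {d} .{{_ : NonZero d}} → m % d ≡ n % d → d ∣ ∣ m - n ∣
m%d≡n%d⇒d∣∣m-n∣ m n {d} m%d≡n%d = divides ∣ m / d - n / d ∣ (begin
  ∣ m - n ∣                                   ≡⟨ cong₂ ∣_-_∣ (m≡m%n+[m/n]*n m d) (m≡m%n+[m/n]*n n d) ⟩
  ∣ m % d + m / d * d - n % d + n / d * d ∣   ≡⟨ cong (λ r → ∣ m % d + m / d * d - r + n / d * d ∣) m%d≡n%d ⟨
  ∣ m % d + m / d * d - m % d + n / d * d ∣   ≡⟨ ∣m+n-m+o∣≡∣n-o∣ (m % d) _ _ ⟩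
  ∣ m / d * d - n / d * d ∣                   ≡⟨ *-distribʳ-∣-∣ d (m / d) (n / d) ⟨
  ∣ m / d - n / d ∣ * d                       ∎)
  where open ≡-Reasoning

∣∧<⇒≡0 : ∀ {m d} .{{_ : NonZero d}} → d ∣ m → m < d → m ≡ 0
∣∧<⇒≡0 {m} {d} d∣m m<d = trans (sym (m<n⇒m%n≡m m<d)) (n∣m⇒m%n≡0 m d d∣m)

hamming-∑ : ∀ {p} .{{_ : NonZero p}} {n} (x : Word p n) → hamming p x ≡ ∑[ j < n ] hamming p [ lookup x j ]
hamming-∑ {p} {n} x = sum-allFin {n} {g = λ j → hamming p [ lookup x j ]} (λ _ → sym (+-identityʳ _))

lee-∑ : ∀ {p} .{{_ : NonZero p}} {n} (x : Word p n) → lee p x ≡ ∑[ j < n ] leeElem p (lookup x j)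
lee-∑ {n = n} x = sum-allFin {n} (λ _ → refl)

-- ∑ₐ leeElem p a, spelled out so that it needs no NonZero p instance: the recursion below passes through leeSum 0.
leeSum : ℕ → ℕ
leeSum p = ∑[ a < p ] (toℕ a ⊓ (p ∸ toℕ a))

leeSum-+2 : ∀ p → leeSum (2 + p) ≡ leeSum p + suc p
leeSum-+2 p = begin
  -- the summand at a = 0 is 0 ⊓ (2 + p) and vanishes definitionally
  ∑[ i < suc p ] leeElem (2 + p) (suc i)                         ≡⟨ sum-init-last (leeElem (2 + p) ∘ suc) ⟩
  ∑[ i < p ] leeElem (2 + p) (suc (inject₁ i)) + leeElem (2 + p) (suc (fromℕ p))
                                                                 ≡⟨ cong₂ _+_ (sum-cong-≗ inner) last ⟩
  ∑[ i < p ] suc (toℕ i ⊓ (p ∸ toℕ i)) + 1                       ≡⟨ cong (_+ 1) (sum-suc {p} (λ i → toℕ i ⊓ (p ∸ toℕ i))) ⟩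
  p + leeSum p + 1                                               ≡⟨ rearrange p (leeSum p) ⟩
  leeSum p + suc p                                               ∎
  where
  open ≡-Reasoning
  rearrange : ∀ m s → m + s + 1 ≡ s + suc m
  rearrange = solve-∀

  inner : ∀ (i : Fin p) → leeElem (2 + p) (suc (inject₁ i)) ≡ suc (toℕ i ⊓ (p ∸ toℕ i))
  inner i rewrite toℕ-inject₁ i = cong (suc (toℕ i) ⊓_) (+-∸-assoc 1 (<⇒≤ (toℕ<n i)))

  last : leeElem (2 + p) (suc (fromℕ p)) ≡ 1
  last rewrite toℕ-fromℕ p | m+n∸n≡m 1 p = cong suc (⊓-zeroʳ p)

leeSum-closed : ∀ p → 4 * leeSum p + p % 2 ≡ p * p
leeSum-closed 0 = refl
leeSum-closed 1 = refl
leeSum-closed (suc (suc p)) = begin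
  4 * leeSum (2 + p) + p % 2          ≡⟨ cong (λ s → 4 * s + p % 2) (leeSum-+2 p) ⟩
  4 * (leeSum p + suc p) + p % 2      ≡⟨ rearrange p (leeSum p) (p % 2) ⟩
  (4 * leeSum p + p % 2) + 4 * suc p  ≡⟨ cong (_+ 4 * suc p) (leeSum-closed p) ⟩
  p * p + 4 * suc p                   ≡⟨ solve (p L.∷ L.[]) ⟩
  (2 + p) * (2 + p)                   ∎
  where
  open ≡-Reasoning
  rearrange : ∀ m s r → 4 * (s + suc m) + r ≡ (4 * s + r) + 4 * suc m
  rearrange = solve-∀

module _ {q : ℕ} (prime : Prime (suc q)) where

  private
    p : ℕ
    p = suc q

  infixl 7 _·_

  _·_ : Fin p → Fin p → Fin p
  _·_ = _*ₚ_ p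

  ·-comm : ∀ a b → a · b ≡ b · a
  ·-comm a b = cong (_mod p) (*-comm (toℕ a) (toℕ b))

  ·-cancelʳ : ∀ {c} → c ≢ zero → Injective _≡_ _≡_ (_· c)
  ·-cancelʳ {c} c≢0 {a} {b} a·c≡b·c =
    [ p∣∣a-b∣⇒a≡b , (λ p∣c → contradiction (toℕ-injective (∣∧<⇒≡0 p∣c (toℕ<n c))) c≢0) ]′
      (euclidsLemma ∣ toℕ a - toℕ b ∣ (toℕ c) prime p∣∣a-b∣*c)
    where
    p∣∣a-b∣*c : p ∣ ∣ toℕ a - toℕ b ∣ * toℕ c
    p∣∣a-b∣*c = subst (p ∣_) (sym (*-distribʳ-∣-∣ (toℕ c) (toℕ a) (toℕ b)))
      (m%d≡n%d⇒d∣∣m-n∣ (toℕ a * toℕ c) (toℕ b * toℕ c)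
        (trans (sym (toℕ-fromℕ< _)) (trans (cong toℕ a·c≡b·c) (toℕ-fromℕ< _))))

    p∣∣a-b∣⇒a≡b : p ∣ ∣ toℕ a - toℕ b ∣ → a ≡ b
    p∣∣a-b∣⇒a≡b p∣∣a-b∣ = toℕ-injective (∣m-n∣≡0⇒m≡n (∣∧<⇒≡0 p∣∣a-b∣
      (≤-<-trans (∣m-n∣≤m⊔n (toℕ a) (toℕ b)) (⊔-pres-<m (toℕ<n a) (toℕ<n b)))))

  scaleW-≡zeroWord : ∀ {a} → a ≢ zero → ∀ {n} (x : Word p n) → scaleW p a x ≡ zeroWord p n → x ≡ zeroWord p n
  scaleW-≡zeroWord a≢0 []      _          = refl
  scaleW-≡zeroWord a≢0 (b ∷ x) ab∷ax≡0∷0 with ∷-injective ab∷ax≡0∷0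
  ... | a·b≡0 , ax≡0 = cong₂ _∷_ (·-cancelʳ a≢0 (trans (·-comm b _) a·b≡0)) (scaleW-≡zeroWord a≢0 x ax≡0)

  ∑-leeElem-·ʳ : ∀ b → ∑[ a < p ] leeElem p (a · b) ≡ hamming p [ b ] * leeSum p
  ∑-leeElem-·ʳ zero    = begin
    ∑[ a < p ] leeElem p (a · zero) ≡⟨ sum-cong-≗ {p} (λ a → cong (λ m → leeElem p (m mod p)) (*-zeroʳ (toℕ a))) ⟩
    ∑[ a < p ] 0                    ≡⟨ sum-const p 0 ⟩
    p * 0                           ≡⟨ *-zeroʳ p ⟩
    0                               ∎
    where open ≡-Reasoning
  ∑-leeElem-·ʳ (suc b) = trans (sum-reindex (leeElem p) (_· suc b) (·-cancelʳ {suc b} λ ())) (sym (+-identityʳ _))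

  ∑-lee-scaleW : ∀ {n} (x : Word p n) → ∑[ a < p ] lee p (scaleW p a x) ≡ hamming p x * leeSum p
  ∑-lee-scaleW {n} x = begin
    ∑[ a < p ] lee p (scaleW p a x)                  ≡⟨ sum-cong-≗ {p} (λ a → lee-∑ (scaleW p a x)) ⟩
    ∑[ a < p ] ∑[ j < n ] leeElem p (lookup (scaleW p a x) j)
                                                     ≡⟨ sum-cong-≗ {p} (λ a → sum-cong-≗ {n} (λ j → cong (leeElem p) (lookup-map j (a ·_) x))) ⟩
    ∑[ a < p ] ∑[ j < n ] leeElem p (a · lookup x j) ≡⟨ ∑-comm (λ a j → leeElem p (a · lookup x j)) ⟩
    ∑[ j < n ] ∑[ a < p ] leeElem p (a · lookup x j) ≡⟨ sum-cong-≗ {n} (λ j → ∑-leeElem-·ʳ (lookup x j)) ⟩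
    ∑[ j < n ] (hamming p [ lookup x j ] * leeSum p) ≡⟨ *-distribʳ-sum (leeSum p) (λ j → hamming p [ lookup x j ]) ⟨
    ∑[ j < n ] hamming p [ lookup x j ] * leeSum p   ≡⟨ cong (_* leeSum p) (hamming-∑ x) ⟨
    hamming p x * leeSum p                           ∎
    where open ≡-Reasoning

  lee-averaging : ∀ {n} {C : Code p n} → IsSubspace p C →
                  ∀ {dL} → (∀ y → C y → y ≢ zeroWord p n → dL ≤ lee p y) →
                  ∀ {x} → C x → x ≢ zeroWord p n → q * dL ≤ hamming p x * leeSum p
  lee-averaging (_ , _ , C-scale) {dL} dL-min {x} x∈C x≢0 = begin
    q * dL                                ≡⟨ sum-const q dL ⟨
    ∑[ i < q ] dL                         ≤⟨ sum-mono-≤ dL≤lee[suc-i·x] ⟩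
    ∑[ i < q ] lee p (scaleW p (suc i) x) ≤⟨ m≤n+m _ (lee p (scaleW p zero x)) ⟩
    ∑[ a < p ] lee p (scaleW p a x)       ≡⟨ ∑-lee-scaleW x ⟩
    hamming p x * leeSum p                ∎
    where
    open ≤-Reasoning
    dL≤lee[suc-i·x] : ∀ i → dL ≤ lee p (scaleW p (suc i) x)
    dL≤lee[suc-i·x] i = dL-min _ (C-scale (suc i) x x∈C) (x≢0 ∘ scaleW-≡zeroWord {suc i} (λ ()) x)

prime≢2⇒odd : ∀ {p} → Prime p → p ≢ 2 → p % 2 ≡ 1
prime≢2⇒odd {p} pr p≢2 with p % 2 in p%2≡r | m%n<n p 2
... | 0           | _               = ⊥-elim ([ (λ ()) , p≢2 ∘ sym ]′ (prime⇒irreducible pr (m%n≡0⇒n∣m p 2 p%2≡r)))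
... | 1           | _               = refl
... | suc (suc _) | s≤s (s≤s ())

leeSum-odd : ∀ q → suc q % 2 ≡ 1 → 4 * leeSum (suc q) ≡ q * (suc q + 1)
leeSum-odd q odd = +-cancelʳ-≡ 1 _ _ (begin
  4 * leeSum (suc q) + 1           ≡⟨ cong (4 * leeSum (suc q) +_) odd ⟨
  4 * leeSum (suc q) + suc q % 2   ≡⟨ leeSum-closed (suc q) ⟩
  suc q * suc q                    ≡⟨ solve (q L.∷ L.[]) ⟩
  q * (suc q + 1) + 1              ∎)
  where open ≡-Reasoning

dL*4≤[p+1]*d : ∀ m .{{_ : NonZero m}} s d dL → 4 * s ≡ m * (suc m + 1) → m * dL ≤ d * s →
               dL * 4 ≤ (suc m + 1) * d
dL*4≤[p+1]*d m s d dL 4s≡m[m+2] mdL≤ds = *-cancelˡ-≤ m (begin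
  m * (dL * 4)           ≡⟨ solve (m L.∷ dL L.∷ L.[]) ⟩
  4 * (m * dL)           ≤⟨ *-monoʳ-≤ 4 mdL≤ds ⟩
  4 * (d * s)            ≡⟨ solve (d L.∷ s L.∷ L.[]) ⟩
  d * (4 * s)            ≡⟨ cong (d *_) 4s≡m[m+2] ⟩
  d * (m * (suc m + 1))  ≡⟨ solve (m L.∷ d L.∷ L.[]) ⟩
  m * ((suc m + 1) * d)  ∎)
  where open ≤-Reasoning

floorμ-upperBound : ∀ {p} → Prime p → ∀ d {dL} → (p ∸ 1) * dL ≤ d * leeSum p → dL ≤ floorμ p d
floorμ-upperBound {0} pr = contradiction pr ¬prime[0]
floorμ-upperBound {1} pr = contradiction pr ¬prime[1]
floorμ-upperBound {2} _ d {dL} dL≤d =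
  subst₂ _≤_ (*-identityˡ dL) (trans (*-identityʳ d) (sym (trans (n/1≡n (1 * d)) (*-identityˡ d)))) dL≤d
floorμ-upperBound {p@(suc q@(suc (suc _)))} pr d {dL} qdL≤dS = begin
  dL              ≡⟨ m*n/n≡m dL 4 ⟨
  dL * 4 / 4      ≤⟨ /-monoˡ-≤ 4 (dL*4≤[p+1]*d q (leeSum p) d dL (leeSum-odd q (prime≢2⇒odd pr (λ ()))) qdL≤dS) ⟩
  (p + 1) * d / 4 ∎
  where open ≤-Reasoning

m≡k+d+s⇒m∸k∸s≡d : ∀ {m} k d s → m ≡ k + d + s → m ∸ k ∸ s ≡ d
m≡k+d+s⇒m∸k∸s≡d k d s refl = begin
  k + d + s ∸ k ∸ s    ≡⟨ cong (λ r → r ∸ k ∸ s) (+-assoc k d s) ⟩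
  k + (d + s) ∸ k ∸ s  ≡⟨ cong (_∸ s) (m+n∸m≡n k (d + s)) ⟩
  d + s ∸ s            ≡⟨ m+n∸n≡m d s ⟩
  d                    ∎
  where open ≡-Reasoning

corollary14 : (p : ℕ) .{{_ : NonZero p}} → Prime p →
    (n k d s : ℕ) (C : Code p n) →
    IsLinearCode p n k d C →
    n + 1 ≡ k + d + s →
    (dL : ℕ) → IsMinLeeDistance p C dL →
    (dL ≤ floorμ p (n + 1 ∸ k ∸ s)) × (floorμ p (n + 1 ∸ k ∸ s) ≡ floorμ p d)
corollary14 zero    pr = contradiction pr ¬prime[0]
corollary14 (suc q) pr n k d s C (subspace , _ , (x , x∈C , x≢0 , wt[x]≡d) , _) n+1≡k+d+s dL (_ , dL-min) =
  subst (dL ≤_) (sym floor≡) (floorμ-upperBound pr d averaged) , floor≡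
  where
  floor≡ : floorμ (suc q) (n + 1 ∸ k ∸ s) ≡ floorμ (suc q) d
  floor≡ = cong (floorμ (suc q)) (m≡k+d+s⇒m∸k∸s≡d k d s n+1≡k+d+s)

  averaged : q * dL ≤ d * leeSum (suc q)
  averaged = subst (λ w → q * dL ≤ w * leeSum (suc q)) wt[x]≡d (lee-averaging pr subspace dL-min x∈C x≢0)
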